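{- Let $\mathcal{A}$ be an $\mathrm{Inf}$-TELA, $w\in\Sigma^\omega$, and $G_w$ the run DAG of $\mathcal{A}$ over $w$. If $w\in\mathcal{L}(\mathcal{A})$, then the labelling algorithm (described in the context) on $G_w$ terminates with $\bot$.
   Context: TELA: $\mathcal{A}=(Q,\delta,I,\Gamma,p,\mathit{Acc})$ with finite states $Q$, $\delta\subseteq Q\times\Sigma\times Q$, initial states $I$, colours $\Gamma$, colouring $p:\delta\to2^\Gamma$, $\mathit{Acc}$ a $\wedge/\vee$-formula over $\mathit{true},\mathit{false},\mathrm{Inf}(c),\mathrm{Fin}(c)$; a run is accepting iff the set of colours on transitions occurring infinitely often satisfies $\mathit{Acc}$ ($\mathrm{Inf}(c)$: $c$ in the set; $\mathrm{Fin}(c)$: not); $\mathcal{L}(\mathcal{A})$: words with an accepting run from $I$. $\mathrm{Inf}$-TELA: no $\mathrm{Fin}$ atoms. $\overline{\mathit{Acc}}$: negation of $\mathit{Acc}$ in negation normal form with $\neg\mathrm{Inf}(c)$ written as variable $c$; $\mathrm{Min}$: the (assumed nonempty) set of $\subseteq$-minimal $M\subseteq\Gamma$ satisfying $\overline{\mathit{Acc}}$; $\mathrm{lex}$: its lexicographically smallest element. Run DAG $G_w=(V,E)$: $(q,i)\in V$ iff some run of $\mathcal{A}$ over $w$ from $I$ has $q$ at position $i$; $((q,i),(q',i'))\in E$ iff $i'=i+1$ and $(q,w_i,q')\in\delta$. For a DAG $G$ and vertex $v$, $\mathrm{reach}_G(v)$ is the set of vertices reachable from $v$ (including $v$); $v$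 is finite if $\mathrm{reach}_G(v)$ is finite. An edge $((q,i),(q',i+1))$ is a $c$-edge if $c\in p((q,w_i,q'))$; $v$ is $c$-endangered in $G$ if it reaches no $c$-edge in $G$, and $C$-endangered if $c$-endangered for all $c\in C$. $v_1,v_2$ converge if $\mathrm{reach}(v_1)\cap\mathrm{reach}(v_2)\ne\emptyset$. For $U\subseteq V$, $\eta:U\to\mathrm{Min}$ is endangered in $G$ if $\eta$ is finite and nonempty, each $v\in U$ is $\eta(v)$-endangered in $G$, and $\eta(v_1)=\eta(v_2)$ for all converging $v_1,v_2\in U$. Labelling algorithm (nondeterministic) on $G_w$: set $i:=0$, $r,m$ empty partial maps. Assign $r(v)=0$, $m(v)=\mathrm{lex}$ to every finite vertex $v$ of $G_w$, and let $G^0$ be $G_w$ without its finite vertices. While $G^i$ is nonempty: if there exist $U\subseteq V(G^i)$ and $\eta:U\to\mathrm{Min}$ endangered in $G^i$ (chosen nondeterministically), then for each $v\in U$ and $u\in\mathrm{reach}_{G^i}(v)$ set $r(u)=i+1$, $m(u)=\eta(v)$; let $G^{i+1}$ be $G^i$ without vertices of rank $i+1$; for each vertex $v$ finite in $G^{i+1}$ set $r(v)=i+2$, $m(v)=\mathrm{lex}$; let $G^{i+2}$ be $G^{i+1}$ without vertices of rank $i+2$; set $i:=i+2$. Otherwise return $\bot$. When the loop exits (because $G^i$ is empty), return $(r,m)$. -}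

module Defs where

open import Data.Nat using (ℕ; zero; suc; _<_; _≥_)
open import Data.Fin using (Fin)
open import Data.Fin.Subset using (Subset; _∈_; _∉_; _⊆_)
open import Data.Product using (Σ; ∃; _×_; _,_)
open import Data.List using (List; [])
import Data.List.Membership.Propositional as LM
open import Relation.Nullary using (¬_)
open import Relation.Binary.PropositionalEquality using (_≡_; _≢_)

data AccF (k : ℕ) : Set where
  tt ff : AccF k
  Inf  : Fin k → AccF k
  Fn   : Fin k → AccF k
  _∧_ _∨_ : AccF k → AccF k → AccF k

data NoFin {k : ℕ} : AccF k → Set where
  tt  : NoFin tt
  ff  : NoFin ff
  inf : ∀ c → NoFin (Inf c)
  and : ∀ {φ ψ} → NoFin φ → NoFin ψ → NoFin (φ ∧ ψ)
  or  : ∀ {φ ψ} → NoFin φ → NoFin ψ → NoFin (φ ∨ ψ)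

-- satisfaction by a set of colours S (given as a predicate: "c occurs infinitely often")
SatAcc : ∀ {k} → AccF k → (Fin k → Set) → Set
SatAcc tt      S = Data.Unit.⊤ where import Data.Unit
SatAcc ff      S = Data.Empty.⊥ where import Data.Empty
SatAcc (Inf c) S = S c
SatAcc (Fn c)  S = ¬ S c
SatAcc (φ ∧ ψ) S = SatAcc φ S × SatAcc ψ S
SatAcc (φ ∨ ψ) S = Data.Sum._⊎_ (SatAcc φ S) (SatAcc ψ S) where import Data.Sum

-- Negation normal form formulas: variable c stands for ¬Inf(c);
-- nvar c stands for ¬¬Inf(c) = Inf(c) (only arises from Fin atoms).
data NNF (k : ℕ) : Set where
  tt ff : NNF k
  var nvar : Fin k → NNF k
  _∧_ _∨_ : NNF k → NNF k → NNF k

negAcc : ∀ {k} → AccF k → NNF k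
negAcc tt      = ff
negAcc ff      = tt
negAcc (Inf c) = var c
negAcc (Fn c)  = nvar c
negAcc (φ ∧ ψ) = negAcc φ ∨ negAcc ψ
negAcc (φ ∨ ψ) = negAcc φ ∧ negAcc ψ

SatN : ∀ {k} → NNF k → Subset k → Set
SatN tt       M = Data.Unit.⊤ where import Data.Unit
SatN ff       M = Data.Empty.⊥ where import Data.Empty
SatN (var c)  M = c ∈ M
SatN (nvar c) M = c ∉ M
SatN (φ ∧ ψ)  M = SatN φ M × SatN ψ M
SatN (φ ∨ ψ)  M = Data.Sum._⊎_ (SatN φ M) (SatN ψ M) where import Data.Sum

record TELA (n σ k : ℕ) : Set where
  field
    δ   : Fin n → Fin σ → Subset n
    I   : Subset n
    col : Fin n → Fin σ → Fin n → Subset k -- colouring p (relevant on transitions only)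
    Acc : AccF k

InfTELA : ∀ {n σ k} → TELA n σ k → Set
InfTELA A = NoFin (TELA.Acc A)

Word : ℕ → Set
Word σ = ℕ → Fin σ

module _ {n σ k : ℕ} (A : TELA n σ k) where
  open TELA A

  IsMin : Subset k → Set
  IsMin M = SatN (negAcc Acc) M
          × (∀ M' → M' ⊆ M → SatN (negAcc Acc) M' → M ⊆ M')

  IsRun : Word σ → (ℕ → Fin n) → Set
  IsRun w ρ = ρ 0 ∈ I × (∀ i → ρ (suc i) ∈ δ (ρ i) (w i))

  InfCol : Word σ → (ℕ → Fin n) → Fin k → Set
  InfCol w ρ c = ∃ λ q → ∃ λ a → ∃ λ q' → c ∈ col q a q'
               × (∀ N → ∃ λ i → i ≥ N × ρ i ≡ q × w i ≡ a × ρ (suc i) ≡ q')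

  Accepts : Word σ → Set
  Accepts w = ∃ λ (ρ : ℕ → Fin n) → IsRun w ρ × SatAcc Acc (InfCol w ρ)

  Vertex : Set
  Vertex = Fin n × ℕ

  -- subgraphs of the run DAG, given by their vertex sets (edges induced)
  Graph : Set₁
  Graph = Vertex → Set

  module _ (w : Word σ) where

    RunDAG : Graph
    RunDAG (q , i) = ∃ λ (ρ : ℕ → Fin n) → ρ 0 ∈ I × (∀ j → j < i → ρ (suc j) ∈ δ (ρ j) (w j)) × ρ i ≡ q

    Edge : Graph → Vertex → Vertex → Set
    Edge G (q , i) (q' , i') = G (q , i) × G (q' , i') × i' ≡ suc i × q' ∈ δ q (w i)

    data Reach (G : Graph) : Vertex → Vertex → Set where
      here  : ∀ {v} → G v → Reach G v v
      there : ∀ {u u' v} → Edge G u u' → Reach G u' v → Reach G u v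

    FiniteV : Graph → Vertex → Set
    FiniteV G v = ∃ λ (xs : List Vertex) → ∀ u → Reach G v u → u LM.∈ xs

    CEdge : Graph → Fin k → Vertex → Vertex → Set
    CEdge G c (q , i) (q' , i') = Edge G (q , i) (q' , i') × c ∈ col q (w i) q'

    CEndangered : Graph → Fin k → Vertex → Set
    CEndangered G c v = ¬ (∃ λ u → ∃ λ u' → Reach G v u × CEdge G c u u')

    SetEndangered : Graph → Subset k → Vertex → Set
    SetEndangered G C v = ∀ c → c ∈ C → CEndangered G c v

    Converge : Graph → Vertex → Vertex → Set
    Converge G v₁ v₂ = ∃ λ x → Reach G v₁ x × Reach G v₂ x

    -- η : U → Min with U a finite (listed) nonempty set of vertices of G
    Endangered : Graph → List Vertex → (Vertex → Subset k) → Set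
    Endangered G U η =
        (U ≢ [])
      × (∀ v → v LM.∈ U → G v)
      × (∀ v → v LM.∈ U → IsMin (η v))
      × (∀ v → v LM.∈ U → SetEndangered G (η v) v)
      × (∀ v₁ v₂ → v₁ LM.∈ U → v₂ LM.∈ U → Converge G v₁ v₂ → η v₁ ≡ η v₂)

    removeReach : Graph → List Vertex → Graph
    removeReach G U u = G u × ¬ (∃ λ v → v LM.∈ U × Reach G v u)

    dropFinite : Graph → Graph
    dropFinite G u = G u × ¬ FiniteV G u

    Nonempty : Graph → Set
    Nonempty G = ∃ λ v → G v

    -- Every execution of the loop, started on G^i = G, terminates
    -- (well-founded execution tree) and returns ⊥: G^i is never empty
    -- at a loop test, and for every nondeterministic choice of an
    -- endangered (U, η) the continuation on G^{i+2} again ends with ⊥.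
    -- (If no endangered η exists the loop returns ⊥.)
    -- The labels r, m do not influence control flow and are omitted.
    data AllBot : Graph → Set₁ where
      allBot : ∀ {G} → Nonempty G
             → (∀ U η → Endangered G U η → AllBot (dropFinite (removeReach G U)))
             → AllBot G

    TerminatesWithBot : Set₁
    TerminatesWithBot = AllBot (dropFinite RunDAG)

module Submission where

open import Defs
open import Data.Nat using (ℕ; zero; suc; _+_; _∸_; _≤_)
open import Data.Nat.Properties
  using (≤-refl; ≤-trans; ≤-reflexive; <-≤-trans; <⇒≱; n≮0; m≤m+n; m≤n+m; m<1+n⇒m≤n; m∸n+n≡m; +-suc)
open import Data.Fin using (Fin)
open import Data.Fin.Subset using (Subset; ⊤; ∣_∣; _-_) renaming (_∈_ to _∈ₛ_)
open import Data.Fin.Subset.Properties using (∈⊤; ∣⊤∣≡n; x∈p⇒∣p-x∣<∣p∣; x∈p∧x≢y⇒x∈p-y)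
open import Data.Fin.Properties using (sequence)
open import Data.Product using (∃; _×_; _,_; proj₁; proj₂)
open import Data.Sum using (_⊎_; inj₁; inj₂)
open import Data.Empty using (⊥-elim)
open import Data.List using (List; []; _∷_; map; concat; allFin)
open import Data.List.Extrema.Nat using (max; v≤max⁺)
open import Data.List.Membership.Propositional using (_∈_)
open import Data.List.Membership.Propositional.Properties using (∈-allFin; ∈-map⁺; ∈-concat⁺′)
open import Data.List.Relation.Unary.Any as Any using (here; there)
import Data.List.Relation.Unary.Any.Properties as Any
open import Function using (_∘_)
open import Level using (0ℓ)
open import Effect.Monad using (RawMonad)
open import Relation.Nullary using (¬_)
open import Relation.Nullary.Negation using (¬¬-Monad)
open import Relation.Binary.PropositionalEquality using (refl; subst)

open RawMonad (¬¬-Monad {a = 0ℓ}) using (return; _>>=_; _<$>_; _<*>_; rawApplicative)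

-- An accepting run ρ is never removed: a vertex v ∈ U with η v ∈ Min is
-- η(v)-endangered, while, Acc having only Inf atoms, every set satisfying
-- the negated condition contains a colour seen infinitely often on ρ; so v
-- cannot reach ρ. The vertices of ρ are moreover infinite, hence survive
-- the removal of finite vertices, and no G^i is empty. For termination, a
-- surviving vertex v ∈ U is infinite, so (König) it has descendants on every
-- later level, and these are removed: each round lowers by one the number
-- of states occupying every sufficiently deep level, so after n rounds such
-- a level would be empty, although ρ passes through it. Finiteness of a
-- vertex is not decidable, so the descendants only exist up to double
-- negation, which suffices because the final step derives a contradiction.

inf-colour-in-negAcc-model : ∀ {k} {φ : AccF k} {S : Fin k → Set} {M} → NoFin φ → SatAcc φ S
                           → SatN (negAcc φ) M → ∃ λ c → c ∈ₛ M × S c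
inf-colour-in-negAcc-model (inf c)   s        m        = c , m , s
inf-colour-in-negAcc-model (and p _) (s , _)  (inj₁ m) = inf-colour-in-negAcc-model p s m
inf-colour-in-negAcc-model (and _ q) (_ , s)  (inj₂ m) = inf-colour-in-negAcc-model q s m
inf-colour-in-negAcc-model (or p _)  (inj₁ s) (m , _)  = inf-colour-in-negAcc-model p s m
inf-colour-in-negAcc-model (or _ q)  (inj₂ s) (_ , m)  = inf-colour-in-negAcc-model q s m

module _ {n σ k} (A : TELA n σ k) (w : Word σ) where
  open TELA A

  level : Vertex A → ℕ
  level = proj₂

  Reach-target : ∀ {G u v} → Reach A w G u v → G v
  Reach-target (here g)    = g
  Reach-target (there _ r) = Reach-target r

  Reach-trans : ∀ {G u v x} → Reach A w G u v → Reach A w G v x → Reach A w G u x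
  Reach-trans (here _)    r′ = r′
  Reach-trans (there e r) r′ = there e (Reach-trans r r′)

  level≤max : ∀ {u xs} → u ∈ xs → level u ≤ max 0 (map level xs)
  level≤max u∈xs = v≤max⁺ 0 _ (inj₂ (Any.map⁺ (Any.map (λ { refl → ≤-refl }) u∈xs)))

  module Run (ρ : ℕ → Fin n) (isRun : ∀ i → ρ (suc i) ∈ₛ δ (ρ i) (w i))
             {G : Graph A} (ρ∈G : ∀ i → G (ρ i , i)) where

    run-edge : ∀ i → Edge A w G (ρ i , i) (ρ (suc i) , suc i)
    run-edge i = ρ∈G i , ρ∈G (suc i) , refl , isRun i

    run-reach : ∀ i d → Reach A w G (ρ i , i) (ρ (d + i) , d + i)
    run-reach i zero    = here (ρ∈G i)
    run-reach i (suc d) =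
      Reach-trans (run-reach i d) (there (run-edge (d + i)) (here (ρ∈G (suc (d + i)))))

    run-reach-≤ : ∀ {i j} → i ≤ j → Reach A w G (ρ i , i) (ρ j , j)
    run-reach-≤ {i} {j} i≤j =
      subst (λ x → Reach A w G (ρ i , i) (ρ x , x)) (m∸n+n≡m i≤j) (run-reach i (j ∸ i))

    run-infinite : ∀ i → ¬ FiniteV A w G (ρ i , i)
    run-infinite i (xs , covers) =
      <⇒≱ (m≤m+n (suc bound) i) (level≤max (covers _ (run-reach i (suc bound))))
      where bound = max 0 (map level xs)

    reaches-run⇒¬CEndangered : ∀ {c v i} → InfCol A w ρ c → Reach A w G v (ρ i , i)
                             → ¬ CEndangered A w G c v
    reaches-run⇒¬CEndangered {i = i} (_ , _ , _ , c∈col , often) r endangered with often i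
    ... | i′ , i≤i′ , refl , refl , refl =
      endangered (_ , _ , Reach-trans r (run-reach-≤ i≤i′) , run-edge i′ , c∈col)

  module _ (H : Graph A) where

    FiniteOrAbsentSuccessor : Vertex A → Fin n → Set
    FiniteOrAbsentSuccessor (q , i) q′ =
      ¬ Edge A w H (q , i) (q′ , suc i) ⊎ FiniteV A w H (q′ , suc i)

    successors-finite⇒finite : ∀ v → (∀ q′ → FiniteOrAbsentSuccessor v q′) → FiniteV A w H v
    successors-finite⇒finite v@(_ , _) succ = v ∷ concat (map reachList (allFin n)) , covers
      where
      reachList : Fin n → List (Vertex A)
      reachList q′ with succ q′
      ... | inj₁ _        = []
      ... | inj₂ (xs , _) = xs

      covers : ∀ u → Reach A w H v u → u ∈ v ∷ concat (map reachList (allFin n))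
      covers u (here _) = here refl
      covers u (there {u' = q′ , _} e@(_ , _ , refl , _) r) =
        there (∈-concat⁺′ in-reachList (∈-map⁺ reachList (∈-allFin q′)))
        where
        in-reachList : u ∈ reachList q′
        in-reachList with succ q′
        ... | inj₁ ¬e         = ⊥-elim (¬e e)
        ... | inj₂ (_ , cov) = cov u r

    infinite⇒¬¬infinite-successor : ∀ v → ¬ FiniteV A w H v
                                  → ¬ ¬ (∃ λ v′ → Edge A w H v v′ × ¬ FiniteV A w H v′)
    infinite⇒¬¬infinite-successor v@(_ , _) v∞ no-succ =
      sequence rawApplicative finite-or-absent (v∞ ∘ successors-finite⇒finite v)
      where
      finite-or-absent : ∀ q′ → ¬ ¬ FiniteOrAbsentSuccessor v q′
      finite-or-absent q′ neither =
        neither (inj₁ λ e → no-succ (_ , e , λ fin → neither (inj₂ fin)))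

    dropFinite-paths : ∀ d v → dropFinite A w H v
                     → ¬ ¬ (∃ λ q → Reach A w (dropFinite A w H) v (q , d + level v))
    dropFinite-paths zero    v v∈G          = return (proj₁ v , here v∈G)
    dropFinite-paths (suc d) v@(_ , i) v∈G@(_ , v∞) = do
      (v′ , (_ , v′∈H , refl , t) , v′∞) ← infinite⇒¬¬infinite-successor v v∞
      (q , r) ← dropFinite-paths d v′ (v′∈H , v′∞)
      return (q , subst (λ x → Reach A w (dropFinite A w H) v (q , x)) (+-suc d i)
                        (there (v∈G , (v′∈H , v′∞) , refl , t) r))

  DescendantsEverywhere : Graph A → Set
  DescendantsEverywhere G =
    ∀ v → G v → ∀ j → level v ≤ j → ¬ ¬ (∃ λ q → Reach A w G v (q , j))

  dropFinite-descendantsEverywhere : ∀ H → DescendantsEverywhere (dropFinite A w H)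
  dropFinite-descendantsEverywhere H v v∈G j lv≤j =
    subst (λ x → ¬ ¬ (∃ λ q → Reach A w (dropFinite A w H) v (q , x))) (m∸n+n≡m lv≤j)
          (dropFinite-paths H (j ∸ level v) v v∈G)

  WidthAtMost : ℕ → Graph A → ℕ → Set
  WidthAtMost m G j = ∃ λ (p : Subset n) → ∣ p ∣ ≤ m × (∀ q → G (q , j) → q ∈ₛ p)

  WidthAtMost-zero : ∀ {G j q} → WidthAtMost 0 G j → ¬ G (q , j)
  WidthAtMost-zero (p , ∣p∣≤0 , covers) g = n≮0 (<-≤-trans (x∈p⇒∣p-x∣<∣p∣ (covers _ g)) ∣p∣≤0)

  WidthAtMost-remove : ∀ {m G G′ j q} → WidthAtMost (suc m) G j → (∀ {u} → G′ u → G u)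
                     → G (q , j) → ¬ G′ (q , j) → WidthAtMost m G′ j
  WidthAtMost-remove {q = q} (p , ∣p∣≤1+m , covers) G′⊆G q∈G q∉G′ =
    p - q ,
    m<1+n⇒m≤n (<-≤-trans (x∈p⇒∣p-x∣<∣p∣ (covers q q∈G)) ∣p∣≤1+m) ,
    λ q′ q′∈G′ → x∈p∧x≢y⇒x∈p-y (covers q′ (G′⊆G q′∈G′)) (λ { refl → q∉G′ q′∈G′ })

  module Labelling (noFin : InfTELA A) (ρ : ℕ → Fin n) (isRun : ∀ i → ρ (suc i) ∈ₛ δ (ρ i) (w i))
                   (accepting : SatAcc Acc (InfCol A w ρ)) where

    record Invariant (m : ℕ) (G : Graph A) : Set where
      field
        run∈       : ∀ i → G (ρ i , i)
        deep       : DescendantsEverywhere G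
        threshold  : ℕ
        narrow     : ∀ j → threshold ≤ j → ¬ ¬ WidthAtMost m G j

    run-avoids-endangered : ∀ {G U η} → (∀ i → G (ρ i , i)) → Endangered A w G U η
                          → ∀ i → removeReach A w G U (ρ i , i)
    run-avoids-endangered ρ∈G (_ , _ , minimal , endangered , _) i = ρ∈G i , avoid
      where
      avoid : ¬ (∃ λ v → v ∈ _ × Reach A w _ v (ρ i , i))
      avoid (v , v∈U , r)
        with c , c∈ηv , c-inf ← inf-colour-in-negAcc-model noFin accepting (proj₁ (minimal v v∈U))
        = Run.reaches-run⇒¬CEndangered ρ isRun ρ∈G c-inf r (endangered v v∈U c c∈ηv)

    Invariant-step : ∀ {m G U η} → Invariant (suc m) G → Endangered A w G U η
                   → Invariant m (dropFinite A w (removeReach A w G U))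
    Invariant-step {U = []} _ (U≢[] , _) = ⊥-elim (U≢[] refl)
    Invariant-step {m} {G} {U = v ∷ U} inv E@(_ , U⊆G , _) = record
      { run∈      = λ i → ρ∈G′ i , Run.run-infinite ρ isRun ρ∈G′ i
      ; deep      = dropFinite-descendantsEverywhere G′
      ; threshold = threshold + level v
      ; narrow    = narrow′
      }
      where
      open Invariant inv
      G′ = removeReach A w G (v ∷ U)
      ρ∈G′ = run-avoids-endangered run∈ E

      shrink : ∀ {j} → WidthAtMost (suc m) G j → ∃ (λ q → Reach A w G v (q , j))
             → WidthAtMost m (dropFinite A w G′) j
      shrink width (q , r) =
        WidthAtMost-remove {G = G} {G′ = dropFinite A w G′} width
          (λ u∈G″ → proj₁ (proj₁ u∈G″)) (Reach-target r) (λ q∈G″ → proj₂ (proj₁ q∈G″) (v , here refl , r))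

      narrow′ : ∀ j → threshold + level v ≤ j → ¬ ¬ WidthAtMost m (dropFinite A w G′) j
      narrow′ j t≤j =
        shrink <$> narrow j (≤-trans (m≤m+n threshold (level v)) t≤j)
               <*> deep v (U⊆G v (here refl)) j (≤-trans (m≤n+m (level v) threshold) t≤j)

    Invariant⇒AllBot : ∀ m {G} → Invariant m G → AllBot A w G
    Invariant⇒AllBot zero {G} inv =
      ⊥-elim (narrow threshold ≤-refl λ width → WidthAtMost-zero {G} width (run∈ threshold))
      where open Invariant inv
    Invariant⇒AllBot (suc m) inv =
      allBot (_ , run∈ 0) λ U η E → Invariant⇒AllBot m (Invariant-step inv E)
      where open Invariant inv

    run∈RunDAG : ρ 0 ∈ₛ I → ∀ i → RunDAG A w (ρ i , i)
    run∈RunDAG ρ0∈I i = ρ , ρ0∈I , (λ j _ → isRun j) , refl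

    Invariant-initial : ρ 0 ∈ₛ I → Invariant n (dropFinite A w (RunDAG A w))
    Invariant-initial ρ0∈I = record
      { run∈      = λ i → run∈RunDAG ρ0∈I i , Run.run-infinite ρ isRun (run∈RunDAG ρ0∈I) i
      ; deep      = dropFinite-descendantsEverywhere (RunDAG A w)
      ; threshold = 0
      ; narrow    = λ j _ → return (⊤ , ≤-reflexive (∣⊤∣≡n n) , λ q _ → ∈⊤)
      }

-- Nonemptiness of Min only serves to make lex well defined; the labels r, m are not modelled.
lemma3 : ∀ {n σ k} (A : TELA n σ k) → InfTELA A
       → (∃ λ M → IsMin A M)
       → (w : Word σ) → Accepts A w
       → TerminatesWithBot A w
lemma3 {n} A noFin _ w (ρ , (ρ0∈I , isRun) , accepting) =
  Invariant⇒AllBot n (Invariant-initial ρ0∈I)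
  where open Labelling A w noFin ρ isRun accepting
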